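{- For every $\varepsilon>0$ there exists a constant $C_0>0$ such that for all $C\ge C_0$ and all integers $n\ge 2$ the following holds. Let $G$ be a graph on $N=C(n-1)n$ vertices (so $N$ is a positive integer) with minimum degree $\delta(G)\ge (1+\varepsilon)\frac{N}{2}$. Then $G$ contains a spanning subdivision of the complete graph $K_n$.
   Context: All graphs are finite and simple. Given a graph $H$, a graph $H'$ is an $H$-subdivision (a subdivision of $H$) if $H'$ is obtained from $H$ by replacing one or more edges of $H$ by paths, where the paths replacing distinct edges are internally vertex-disjoint and their interior vertices are new vertices. A subgraph of $G$ is spanning if it contains every vertex of $G$. $\delta(G)$ denotes the minimum degree of $G$. -}

module Defs where

open import Data.Nat using (ℕ; zero; suc; _+_; _*_; _∸_; _≤_; _<_)
open import Data.Bool using (Bool; true; false; if_then_else_; T)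
open import Data.Fin using (Fin) renaming (_<_ to _<ᶠ_)
open import Data.List using (List; []; _∷_; map; allFin)
open import Data.Nat.ListAction using (sum)
open import Data.List.Membership.Propositional using (_∈_)
open import Data.List.Relation.Unary.Unique.Propositional using (Unique)
open import Data.Product using (Σ; _×_; ∃; ∃-syntax)
open import Data.Sum using (_⊎_)
open import Relation.Binary.PropositionalEquality using (_≡_; _≢_)

record Graph (N : ℕ) : Set where
  field
    adj    : Fin N → Fin N → Bool
    sym    : ∀ u v → adj u v ≡ adj v u
    irrefl : ∀ v → adj v v ≡ false
open Graph public

degree : ∀ {N} → Graph N → Fin N → ℕ
degree {N} G v = sum (map (λ u → if adj G v u then 1 else 0) (allFin N))

Chain : ∀ {N} → Graph N → Fin N → List (Fin N) → Fin N → Set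
Chain G x []       y = T (adj G x y)
Chain G x (z ∷ zs) y = T (adj G x z) × Chain G z zs y

record SpanningSubdivision {N : ℕ} (G : Graph N) (n : ℕ) : Set where
  field
    branch       : Fin n → Fin N
    branch-inj   : ∀ i j → branch i ≡ branch j → i ≡ j
    interior     : (i j : Fin n) → i <ᶠ j → List (Fin N)
    path         : ∀ i j (p : i <ᶠ j) → Chain G (branch i) (interior i j p) (branch j)
    int-unique   : ∀ i j (p : i <ᶠ j) → Unique (interior i j p)
    int-avoid    : ∀ i j (p : i <ᶠ j) k v → v ∈ interior i j p → v ≢ branch k
    int-disjoint : ∀ i j (p : i <ᶠ j) i' j' (p' : i' <ᶠ j') v →
                   v ∈ interior i j p → v ∈ interior i' j' p' → (i ≡ i') × (j ≡ j')
    spanning     : ∀ v → (∃[ k ] v ≡ branch k)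
                         ⊎ (∃[ i ] ∃[ j ] Σ (i <ᶠ j) λ p → v ∈ interior i j p)

module Submission where

-- With ε = p/q and C₀ = 7q, the degree condition gives deg v + deg w ≥ N + 2(n + n²) + 1
-- for all vertices v, w. Fix n branch vertices. Any two vertices then have more than
-- 2(n + n²) common neighbours, so every pair {i, j} other than {0, 1} can greedily be given
-- a private common neighbour of its branch vertices as a one-vertex interior. The set X of
-- branch and middle vertices has at most n + n² elements, so any two vertices have more
-- than N neighbours outside X in total. By Pósa's rotation-extension argument this
-- Ore-type condition yields a Hamiltonian cycle of G - X, and from it a path from branch
-- vertex 0 to branch vertex 1 through all of G - X, which subdivides the edge {0, 1}.

open import Defs
open import Data.Nat using (ℕ; _+_; _*_; _∸_; _≤_; _<_)
open import Data.Product using (_×_; ∃-syntax)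
open import Data.Nat as ℕ using (z≤n; s≤s)
open import Data.Nat.Properties
open import Data.Nat.ListAction using (sum)
open import Data.Nat.ListAction.Properties using (sum-↭)
open import Data.Nat.Tactic.RingSolver using (solve-∀)
open import Algebra.Properties.CommutativeSemigroup +-commutativeSemigroup using (interchange)
open import Data.Bool using (Bool; true; false; if_then_else_; T; _∧_; _∨_; not)
open import Data.Bool.Properties using (∧-identityʳ; T-∧)
open import Data.Unit using (⊤; tt)
open import Data.Empty using (⊥; ⊥-elim)
open import Data.Fin using (Fin; zero; suc; inject≤) renaming (_<_ to _<ᶠ_)
open import Data.Fin.Properties using (any?; injective⇒≤; inject≤-injective) renaming (_≟_ to _≟ᶠ_; _<?_ to _<ᶠ?_)
open import Data.List using (List; []; _∷_; _++_; _∷ʳ_; map; filter; allFin; length; lookup; reverse; foldl; cartesianProduct)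
open import Data.List.Properties
  using (length-++; length-map; length-filter; length-tabulate; ++-assoc; ++-identityʳ; ∷ʳ-injective; reverse-++; unfold-reverse)
open import Data.List.Membership.Propositional using (_∈_; _∉_; find; lose)
open import Data.List.Membership.Propositional.Properties
  using (∈-allFin; ∈-lookup; ∈-∃++; ∈-map⁺; ∈-map⁻; ∈-++⁺ˡ; ∈-++⁺ʳ; ∈-++⁻; ∈-filter⁺; ∈-filter⁻; ∈-cartesianProduct⁺)
open import Data.List.Relation.Unary.Any as Any using (here; there)
open import Data.List.Relation.Unary.All as All using (All; []; _∷_)
open import Data.List.Relation.Unary.All.Properties using (¬Any⇒All¬) renaming (++⁺ to All-++⁺)
open import Data.List.Relation.Unary.AllPairs using ([]; _∷_)
open import Data.List.Relation.Unary.Linked using (Linked; []; [-]; _∷_)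
open import Data.List.Relation.Unary.Unique.Propositional using (Unique)
open import Data.List.Relation.Unary.Unique.Propositional.Properties using (allFin⁺)
open import Data.List.Relation.Binary.Permutation.Propositional using (_↭_; ↭-sym; prep; ↭⇒↭ₛ)
open import Data.List.Relation.Binary.Permutation.Propositional.Properties
  using (map⁺; All-resp-↭; ∈-resp-↭; ++-comm; ↭-reverse; ++⁺ˡ; ↭-length)
import Data.List.Relation.Binary.Permutation.Setoid.Properties as Perm
open import Data.Product using (Σ; ∃; ∃₂; _,_; proj₁; proj₂)
open import Data.Product.Properties using (≡-dec; ,-injective)
open import Data.Sum as Sum using (_⊎_; inj₁; inj₂)
open import Relation.Binary.PropositionalEquality using (_≡_; _≢_; refl; trans; cong; cong₂; subst)
import Relation.Binary.PropositionalEquality as ≡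
open import Relation.Nullary using (Dec; does; yes; no; ¬?; _×-dec_)
open import Relation.Nullary.Decidable using (T?)
open import Function using (_∘_; flip; Equivalence)

𝟙 : Bool → ℕ
𝟙 b = if b then 1 else 0

𝟙≤1 : ∀ b → 𝟙 b ≤ 1
𝟙≤1 true  = ≤-refl
𝟙≤1 false = z≤n

𝟙-mono : ∀ {a b} → (T a → T b) → 𝟙 a ≤ 𝟙 b
𝟙-mono {true}  {true}  _ = ≤-refl
𝟙-mono {true}  {false} f = ⊥-elim (f tt)
𝟙-mono {false}         _ = z≤n

𝟙-∨ : ∀ a b → 𝟙 (a ∨ b) ≤ 𝟙 a + 𝟙 b
𝟙-∨ true  b = s≤s z≤n
𝟙-∨ false b = ≤-refl

𝟙-∧ : ∀ a b → 𝟙 a + 𝟙 b ≤ 1 + 𝟙 (a ∧ b)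
𝟙-∧ true  b = ≤-refl
𝟙-∧ false b = 𝟙≤1 b

𝟙-split : ∀ a b → 𝟙 b ≤ 𝟙 a + 𝟙 (b ∧ not a)
𝟙-split true  true  = s≤s z≤n
𝟙-split true  false = z≤n
𝟙-split false true  = ≤-refl
𝟙-split false false = z≤n

𝟙-disjoint : ∀ {a b} → (T a → T b → ⊥) → 𝟙 a + 𝟙 b ≤ 1
𝟙-disjoint {true}  {true}  disj = ⊥-elim (disj tt tt)
𝟙-disjoint {true}  {false} disj = ≤-refl
𝟙-disjoint {false} {b}     disj = 𝟙≤1 b

∧-distribʳ-∨ : ∀ a b c → T ((a ∨ b) ∧ c) → T ((a ∧ c) ∨ (b ∧ c))
∧-distribʳ-∨ true  b     true t = tt
∧-distribʳ-∨ false true  true t = tt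

module _ {a} {A : Set a} where

  sumBy : List A → (A → ℕ) → ℕ
  sumBy xs h = sum (map h xs)

  sumBy-mono : ∀ xs {h k : A → ℕ} → (∀ x → h x ≤ k x) → sumBy xs h ≤ sumBy xs k
  sumBy-mono []       h≤k = z≤n
  sumBy-mono (x ∷ xs) h≤k = +-mono-≤ (h≤k x) (sumBy-mono xs h≤k)

  sumBy-+ : ∀ xs (h k : A → ℕ) → sumBy xs (λ x → h x + k x) ≡ sumBy xs h + sumBy xs k
  sumBy-+ []       h k = refl
  sumBy-+ (x ∷ xs) h k = trans (cong (h x + k x +_) (sumBy-+ xs h k)) (interchange (h x) (k x) _ _)

  sumBy-const1 : ∀ xs → sumBy xs (λ _ → 1) ≡ length xs
  sumBy-const1 []       = refl
  sumBy-const1 (x ∷ xs) = cong ℕ.suc (sumBy-const1 xs)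

  sumBy-↭ : ∀ {xs ys} (h : A → ℕ) → xs ↭ ys → sumBy xs h ≡ sumBy ys h
  sumBy-↭ h p = sum-↭ (map⁺ h p)

  sumBy-zero : ∀ xs → sumBy xs (λ _ → 0) ≡ 0
  sumBy-zero []       = refl
  sumBy-zero (x ∷ xs) = sumBy-zero xs

  sumBy-pos : ∀ xs (f : A → Bool) → 0 < sumBy xs (𝟙 ∘ f) → ∃ λ x → x ∈ xs × T (f x)
  sumBy-pos (x ∷ xs) f pos with f x in fx
  ... | true  = x , here refl , subst T (≡.sym fx) tt
  ... | false with sumBy-pos xs f pos
  ...   | y , y∈ , fy = y , there y∈ , fy

  lookup-injective : ∀ {xs : List A} → Unique xs → ∀ i j → lookup xs i ≡ lookup xs j → i ≡ j
  lookup-injective {x ∷ xs} (x∉ ∷ u) zero    zero    eq = refl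
  lookup-injective {x ∷ xs} (x∉ ∷ u) zero    (suc j) eq = ⊥-elim (All.lookup x∉ (∈-lookup j) eq)
  lookup-injective {x ∷ xs} (x∉ ∷ u) (suc i) zero    eq = ⊥-elim (All.lookup x∉ (∈-lookup i) (≡.sym eq))
  lookup-injective {x ∷ xs} (x∉ ∷ u) (suc i) (suc j) eq = cong suc (lookup-injective u i j eq)

length-allFin : ∀ n → length (allFin n) ≡ n
length-allFin n = length-tabulate {n = n} (λ i → i)

Unique-resp-↭ : ∀ {a} {A : Set a} {xs ys : List A} → xs ↭ ys → Unique xs → Unique ys
Unique-resp-↭ {A = A} p = Perm.Unique-resp-↭ (≡.setoid A) (↭⇒↭ₛ p)

length-cartesianProduct : ∀ {a b} {A : Set a} {B : Set b} (xs : List A) (ys : List B) →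
                          length (cartesianProduct xs ys) ≡ length xs * length ys
length-cartesianProduct []       ys = refl
length-cartesianProduct (x ∷ xs) ys =
  trans (length-++ (map (x ,_) ys)) (cong₂ _+_ (length-map (x ,_) ys) (length-cartesianProduct xs ys))

module Counting {N : ℕ} where

  open import Data.List.Membership.DecPropositional (_≟ᶠ_ {N}) public using (_∈?_)

  _≡ᵇ_ : Fin N → Fin N → Bool
  u ≡ᵇ v = does (u ≟ᶠ v)

  _∈ᵇ_ : Fin N → List (Fin N) → Bool
  u ∈ᵇ xs = does (u ∈? xs)

  ∈⇒∈ᵇ : ∀ {u xs} → u ∈ xs → T (u ∈ᵇ xs)
  ∈⇒∈ᵇ {u} {xs} u∈ with u ∈? xs
  ... | yes _  = tt
  ... | no u∉  = u∉ u∈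

  ∉ᵇ⇒∉ : ∀ {u xs} → T (not (u ∈ᵇ xs)) → u ∉ xs
  ∉ᵇ⇒∉ {u} {xs} t with u ∈? xs
  ... | no u∉ = u∉

  count : (Fin N → Bool) → ℕ
  count f = sumBy (allFin N) (𝟙 ∘ f)

  count-mono : ∀ {f g} → (∀ u → T (f u) → T (g u)) → count f ≤ count g
  count-mono f⇒g = sumBy-mono (allFin N) (λ u → 𝟙-mono (f⇒g u))

  count-true : count (λ _ → true) ≡ N
  count-true = trans (sumBy-const1 (allFin N)) (length-allFin N)

  count-∨ : ∀ f g → count (λ u → f u ∨ g u) ≤ count f + count g
  count-∨ f g = ≤-trans (sumBy-mono (allFin N) (λ u → 𝟙-∨ (f u) (g u)))
                        (≤-reflexive (sumBy-+ (allFin N) _ _))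

  count-split : ∀ f g → count f ≤ count g + count (λ u → f u ∧ not (g u))
  count-split f g = ≤-trans (sumBy-mono (allFin N) (λ u → 𝟙-split (g u) (f u)))
                            (≤-reflexive (sumBy-+ (allFin N) _ _))

  count-∧ : ∀ f g → count f + count g ≤ N + count (λ u → f u ∧ g u)
  count-∧ f g = begin
    count f + count g                          ≡⟨ sumBy-+ (allFin N) _ _ ⟨
    sumBy (allFin N) (λ u → 𝟙 (f u) + 𝟙 (g u)) ≤⟨ sumBy-mono (allFin N) (λ u → 𝟙-∧ (f u) (g u)) ⟩
    sumBy (allFin N) (λ u → 1 + 𝟙 (f u ∧ g u)) ≡⟨ sumBy-+ (allFin N) _ _ ⟩
    sumBy (allFin N) (λ _ → 1) + count (λ u → f u ∧ g u) ≡⟨ cong (_+ count (λ u → f u ∧ g u)) count-true ⟩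
    N + count (λ u → f u ∧ g u)                ∎
    where open ≤-Reasoning

  count-pos : ∀ f → 0 < count f → ∃ (T ∘ f)
  count-pos f pos with sumBy-pos (allFin N) f pos
  ... | u , _ , fu = u , fu

  count-≡ᵇ∧ : ∀ x (g : Fin N → Bool) → count (λ u → u ≡ᵇ x ∧ g u) ≤ 𝟙 (g x)
  count-≡ᵇ∧ x g = go (allFin N) (allFin⁺ N)
    where
    go : ∀ us → Unique us → sumBy us (λ u → 𝟙 (u ≡ᵇ x ∧ g u)) ≤ 𝟙 (g x)
    go []       _ = z≤n
    go (u ∷ us) (u∉ ∷ uq) with u ≟ᶠ x
    ... | no _     = go us uq
    ... | yes refl = ≤-reflexive (trans (cong (𝟙 (g u) +_) (rest us u∉)) (+-identityʳ _))
      where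
      rest : ∀ vs → All (u ≢_) vs → sumBy vs (λ v → 𝟙 (v ≡ᵇ u ∧ g v)) ≡ 0
      rest []       []          = refl
      rest (v ∷ vs) (u≢v ∷ u∉) with v ≟ᶠ u
      ... | yes refl = ⊥-elim (u≢v refl)
      ... | no _     = rest vs u∉

  count-∈ᵇ∧ : ∀ xs (g : Fin N → Bool) → count (λ u → u ∈ᵇ xs ∧ g u) ≤ sumBy xs (𝟙 ∘ g)
  count-∈ᵇ∧ []       g = ≤-reflexive (sumBy-zero (allFin N))
  count-∈ᵇ∧ (x ∷ xs) g = begin
    count (λ u → (u ≡ᵇ x ∨ u ∈ᵇ xs) ∧ g u)                    ≤⟨ count-mono (λ u → ∧-distribʳ-∨ (u ≡ᵇ x) (u ∈ᵇ xs) (g u)) ⟩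
    count (λ u → (u ≡ᵇ x ∧ g u) ∨ (u ∈ᵇ xs ∧ g u))            ≤⟨ count-∨ _ _ ⟩
    count (λ u → u ≡ᵇ x ∧ g u) + count (λ u → u ∈ᵇ xs ∧ g u)  ≤⟨ +-mono-≤ (count-≡ᵇ∧ x g) (count-∈ᵇ∧ xs g) ⟩
    𝟙 (g x) + sumBy xs (𝟙 ∘ g)                                 ∎
    where open ≤-Reasoning

  count-∈ᵇ : ∀ xs → count (_∈ᵇ xs) ≤ length xs
  count-∈ᵇ xs = begin
    count (_∈ᵇ xs)                  ≤⟨ count-mono {_∈ᵇ xs} {λ u → u ∈ᵇ xs ∧ true}
                                                  (λ u → subst T (≡.sym (∧-identityʳ (u ∈ᵇ xs)))) ⟩
    count (λ u → u ∈ᵇ xs ∧ true)    ≤⟨ count-∈ᵇ∧ xs (λ _ → true) ⟩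
    sumBy xs (λ _ → 1)              ≡⟨ sumBy-const1 xs ⟩
    length xs                       ∎
    where open ≤-Reasoning

  count-disjoint : ∀ f g → (∀ u → T (f u) → T (g u) → ⊥) → count f + count g ≤ N
  count-disjoint f g disj = begin
    count f + count g                          ≡⟨ sumBy-+ (allFin N) _ _ ⟨
    sumBy (allFin N) (λ u → 𝟙 (f u) + 𝟙 (g u)) ≤⟨ sumBy-mono (allFin N) (λ u → 𝟙-disjoint (disj u)) ⟩
    sumBy (allFin N) (λ _ → 1)                 ≡⟨ count-true ⟩
    N                                          ∎
    where open ≤-Reasoning

  Unique⇒length≤ : ∀ {xs : List (Fin N)} → Unique xs → length xs ≤ N
  Unique⇒length≤ {xs} u = injective⇒≤ {f = lookup xs} (lookup-injective u _ _)

module _ {a} {A : Set a} where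

  last⁺ : A → List A → A
  last⁺ x []       = x
  last⁺ x (y ∷ ys) = last⁺ y ys

  last⁺-++ : ∀ (x : A) xs y ys → last⁺ x (xs ++ y ∷ ys) ≡ last⁺ y ys
  last⁺-++ x []       y ys = refl
  last⁺-++ x (z ∷ xs) y ys = last⁺-++ z xs y ys

  init⁺ : A → List A → List A
  init⁺ x []       = []
  init⁺ x (y ∷ ys) = x ∷ init⁺ y ys

  init⁺-∷ʳ-last⁺ : ∀ (x : A) xs → init⁺ x xs ∷ʳ last⁺ x xs ≡ x ∷ xs
  init⁺-∷ʳ-last⁺ x []       = refl
  init⁺-∷ʳ-last⁺ x (y ∷ ys) = cong (x ∷_) (init⁺-∷ʳ-last⁺ y ys)

  reverse-∷ : ∀ (x : A) xs → reverse (x ∷ xs) ≡ last⁺ x xs ∷ reverse (init⁺ x xs)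
  reverse-∷ x xs = trans (cong reverse (≡.sym (init⁺-∷ʳ-last⁺ x xs)))
                         (reverse-++ (init⁺ x xs) (last⁺ x xs ∷ []))

  sumInit : (A → ℕ) → List A → ℕ
  sumInit h []           = 0
  sumInit h (x ∷ [])     = 0
  sumInit h (x ∷ y ∷ ys) = h x + sumInit h (y ∷ ys)

  sumBy≡sumInit+last⁺ : ∀ (h : A → ℕ) x xs → sumBy (x ∷ xs) h ≡ sumInit h (x ∷ xs) + h (last⁺ x xs)
  sumBy≡sumInit+last⁺ h x []       = +-comm (h x) 0
  sumBy≡sumInit+last⁺ h x (y ∷ ys) =
    trans (cong (h x +_) (sumBy≡sumInit+last⁺ h y ys)) (≡.sym (+-assoc (h x) _ _))

  sumInit-∷ʳ : ∀ (h : A → ℕ) x xs y → sumInit h (x ∷ xs ∷ʳ y) ≡ sumBy (x ∷ xs) h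
  sumInit-∷ʳ h x []       y = refl
  sumInit-∷ʳ h x (z ∷ zs) y = cong (h x +_) (sumInit-∷ʳ h z zs y)

  record Consecutive (longPath Q : A → Set) (x : A) (xs : List A) : Set a where
    field
      mid   : List A
      next  : A
      after : List A
      split : xs ≡ mid ++ next ∷ after
      P-last : longPath (last⁺ x mid)
      Q-next : Q next

  ∷-Consecutive : ∀ {longPath Q : A → Set} x {y ys} → Consecutive longPath Q y ys → Consecutive longPath Q x (y ∷ ys)
  ∷-Consecutive x c = record
    { mid = _ ∷ mid ; next = next ; after = after ; split = cong (_ ∷_) split
    ; P-last = P-last ; Q-next = Q-next }
    where open Consecutive c

  -- f is counted at the first and g at the second entries of the length xs consecutive
  -- pairs of x ∷ xs, so some pair is counted twice.
  consecutive-pigeonhole : ∀ (f g : A → Bool) x xs →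
    length xs < sumInit (𝟙 ∘ f) (x ∷ xs) + sumBy xs (𝟙 ∘ g) → Consecutive (T ∘ f) (T ∘ g) x xs
  consecutive-pigeonhole f g x (y ∷ ys) lt with f x in fx | g y in gy
  ... | true  | true  = record { mid = [] ; next = y ; after = ys ; split = refl
                              ; P-last = subst T (≡.sym fx) tt ; Q-next = subst T (≡.sym gy) tt }
  ... | true  | false = ∷-Consecutive x (consecutive-pigeonhole f g y ys (≤-pred lt))
  ... | false | true  = ∷-Consecutive x (consecutive-pigeonhole f g y ys (≤-pred (subst (length (y ∷ ys) <_) (+-suc _ _) lt)))
  ... | false | false = ∷-Consecutive x (consecutive-pigeonhole f g y ys (≤-trans (n≤1+n _) lt))

module Walks {N : ℕ} (G : Graph N) where

  Adj : Fin N → Fin N → Set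
  Adj u v = T (adj G u v)

  Adj-sym : ∀ {u v} → Adj u v → Adj v u
  Adj-sym {u} {v} = subst T (Graph.sym G u v)

  Walk : List (Fin N) → Set
  Walk = Linked Adj

  walk-++ : ∀ {x xs y ys} → Walk (x ∷ xs) → Adj (last⁺ x xs) y → Walk (y ∷ ys) → Walk (x ∷ xs ++ y ∷ ys)
  walk-++ {xs = []}     [-]      a w′ = a ∷ w′
  walk-++ {xs = _ ∷ _}  (b ∷ w)  a w′ = b ∷ walk-++ w a w′

  walk-++⁻ : ∀ {x} xs {y ys} → Walk (x ∷ xs ++ y ∷ ys) → Walk (x ∷ xs) × Adj (last⁺ x xs) y × Walk (y ∷ ys)
  walk-++⁻ []       (a ∷ w) = [-] , a , w
  walk-++⁻ (_ ∷ xs) (b ∷ w) with walk-++⁻ xs w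
  ... | w₁ , a , w₂ = b ∷ w₁ , a , w₂

  walk-reverse : ∀ {x xs} → Walk (x ∷ xs) → Walk (reverse (x ∷ xs))
  walk-reverse = reverse-onto [-]
    where
    reverse-onto : ∀ {x acc xs} → Walk (x ∷ acc) → Walk (x ∷ xs) → Walk (foldl (flip _∷_) (x ∷ acc) xs)
    reverse-onto r [-]     = r
    reverse-onto r (a ∷ w) = reverse-onto (Adj-sym a ∷ r) w

  walk⇒chain : ∀ {s x xs t} → Adj s x → Walk (x ∷ xs) → Adj (last⁺ x xs) t → Chain G s (x ∷ xs) t
  walk⇒chain a [-]      b = a , b
  walk⇒chain a (a′ ∷ w) b = a , walk⇒chain a′ w b

  Closed : List (Fin N) → Set
  Closed []       = ⊤
  Closed (x ∷ xs) = Adj (last⁺ x xs) x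

  Cycle : List (Fin N) → Set
  Cycle xs = Walk xs × Closed xs

  cycle-rotate : ∀ xs y ys → Cycle (xs ++ y ∷ ys) → Cycle (y ∷ ys ++ xs)
  cycle-rotate []       y ys c = subst (λ zs → Cycle (y ∷ zs)) (≡.sym (++-identityʳ ys)) c
  cycle-rotate (x ∷ xs) y ys (w , closed) with walk-++⁻ xs w
  ... | w₁ , a , w₂ =
    walk-++ w₂ (subst (λ z → Adj z x) (last⁺-++ x xs y ys) closed) w₁ ,
    subst (λ z → Adj z y) (≡.sym (last⁺-++ y ys x xs)) a

  cycle-by-reversal : ∀ {h} mid {b} after → Walk (h ∷ mid ++ b ∷ after) →
    Adj (last⁺ b after) (last⁺ h mid) → Adj h b → Cycle (h ∷ mid ++ reverse (b ∷ after))
  cycle-by-reversal {h} mid {b} after w a₁ a₂ with walk-++⁻ mid w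
  ... | w₁ , _ , w₂ = walk , closed
    where
    walk : Walk (h ∷ mid ++ reverse (b ∷ after))
    walk = subst (λ zs → Walk (h ∷ mid ++ zs)) (≡.sym (reverse-∷ b after))
             (walk-++ w₁ (Adj-sym a₁) (subst Walk (reverse-∷ b after) (walk-reverse w₂)))
    last≡b : last⁺ h (mid ++ reverse (b ∷ after)) ≡ b
    last≡b = begin
      last⁺ h (mid ++ reverse (b ∷ after))       ≡⟨ cong (λ zs → last⁺ h (mid ++ zs)) (unfold-reverse b after) ⟩
      last⁺ h (mid ++ reverse after ++ b ∷ [])   ≡⟨ cong (last⁺ h) (++-assoc mid (reverse after) (b ∷ [])) ⟨
      last⁺ h ((mid ++ reverse after) ++ b ∷ []) ≡⟨ last⁺-++ h (mid ++ reverse after) b [] ⟩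
      b                                          ∎
      where open ≡.≡-Reasoning
    closed : Closed (h ∷ mid ++ reverse (b ∷ after))
    closed = subst (λ z → Adj z h) (≡.sym last≡b) (Adj-sym a₂)

  rotate-to : ∀ {c C} → c ∈ C → Cycle C → ∃ λ C′ → c ∷ C′ ↭ C × Cycle (c ∷ C′)
  rotate-to {c} c∈ cyc with ∈-∃++ c∈
  ... | C₁ , C₂ , refl = C₂ ++ C₁ , ++-comm (c ∷ C₂) C₁ , cycle-rotate C₁ c C₂ cyc

  sumBy-adj-head : ∀ v xs → sumBy (v ∷ xs) (𝟙 ∘ adj G v) ≡ sumBy xs (𝟙 ∘ adj G v)
  sumBy-adj-head v xs = cong (λ b → 𝟙 b + sumBy xs (𝟙 ∘ adj G v)) (irrefl G v)

  sumBy-adj-last⁺ : ∀ x xs → let v = last⁺ x xs in sumBy (x ∷ xs) (𝟙 ∘ adj G v) ≡ sumInit (𝟙 ∘ adj G v) (x ∷ xs)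
  sumBy-adj-last⁺ x xs = trans (sumBy≡sumInit+last⁺ (𝟙 ∘ adj G v) x xs)
                               (trans (cong (λ b → sumInit (𝟙 ∘ adj G v) (x ∷ xs) + 𝟙 b) (irrefl G v)) (+-identityʳ _))
    where v = last⁺ x xs

-- Spanning paths outside a vertex set under an Ore-type condition

module HamiltonPathOutside {N : ℕ} (G : Graph N) (X : List (Fin N)) where
  open Walks G
  open Counting {N}

  degreeOutside : Fin N → ℕ
  degreeOutside v = count (λ u → adj G v u ∧ not (u ∈ᵇ X))

  NeighboursOutsideIn : Fin N → List (Fin N) → Set
  NeighboursOutsideIn v L = ∀ u → Adj v u → u ∉ X → u ∈ L

  degreeOutside-≤ : ∀ {v L} → NeighboursOutsideIn v L → degreeOutside v ≤ sumBy L (𝟙 ∘ adj G v)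
  degreeOutside-≤ {v} {L} nbs = ≤-trans (count-mono inL) (count-∈ᵇ∧ L (adj G v))
    where
    inL : ∀ u → T (adj G v u ∧ not (u ∈ᵇ X)) → T (u ∈ᵇ L ∧ adj G v u)
    inL u t with Equivalence.to T-∧ t
    ... | a , u∉X = Equivalence.from T-∧ (∈⇒∈ᵇ (nbs u a (∉ᵇ⇒∉ u∉X)) , a)

  record SpansOutside (L : List (Fin N)) : Set where
    field
      unique  : Unique L
      outside : All (_∉ X) L
      covers  : ∀ u → u ∉ X → u ∈ L

  OutsidePath : List (Fin N) → Set
  OutsidePath L = Unique L × Walk L × All (_∉ X) L

  SpansOutside-resp-↭ : ∀ {L L′} → L ↭ L′ → SpansOutside L → SpansOutside L′
  SpansOutside-resp-↭ p s = record
    { unique  = Unique-resp-↭ p unique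
    ; outside = All-resp-↭ p outside
    ; covers  = λ u u∉X → ∈-resp-↭ p (covers u u∉X)
    }
    where open SpansOutside s

  spans⇒neighbours : ∀ {v L} → SpansOutside L → NeighboursOutsideIn v L
  spans⇒neighbours sp u _ = SpansOutside.covers sp u

  HamiltonCycle : List (Fin N) → Set
  HamiltonCycle C = Cycle C × SpansOutside C

  record SpanningOutsidePath (s t : Fin N) : Set where
    field
      interior : List (Fin N)
      chain    : Chain G s interior t
      spans    : SpansOutside interior

  LongerOutsidePath : ℕ → Set
  LongerOutsidePath k = ∃₂ λ h t → OutsidePath (h ∷ t) × k < length (h ∷ t)

  module Ore (ore : ∀ v w → N < degreeOutside v + degreeOutside w) where

    outside-neighbour : ∀ v L → (∃ λ u → Adj v u × u ∉ X × u ∉ L) ⊎ NeighboursOutsideIn v L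
    outside-neighbour v L with any? (λ u → T? (adj G v u) ×-dec ¬? (u ∈? X) ×-dec ¬? (u ∈? L))
    ... | yes found = inj₁ found
    ... | no none   = inj₂ inL
      where
      inL : NeighboursOutsideIn v L
      inL u a u∉X with u ∈? L
      ... | yes u∈ = u∈
      ... | no u∉  = ⊥-elim (none (u , a , u∉X , u∉))

    extend-end : ∀ {h t u} → OutsidePath (h ∷ t) → Adj (last⁺ h t) u → u ∉ X → u ∉ h ∷ t →
                 LongerOutsidePath (length (h ∷ t))
    extend-end {h} {t} {u} (uq , w , out) a u∉X u∉ =
      h , t ++ u ∷ [] ,
      ( Unique-resp-↭ (++-comm (u ∷ []) (h ∷ t)) (¬Any⇒All¬ (h ∷ t) u∉ ∷ uq)
      , walk-++ w a [-]
      , All-++⁺ out (u∉X ∷ []) ) ,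
      ≤-reflexive (cong ℕ.suc (trans (+-comm 1 (length t)) (≡.sym (length-++ t))))

    extend-start : ∀ {h t u} → OutsidePath (h ∷ t) → Adj h u → u ∉ X → u ∉ h ∷ t →
                   LongerOutsidePath (length (h ∷ t))
    extend-start {h} {t} {u} (uq , w , out) a u∉X u∉ =
      u , h ∷ t , (¬Any⇒All¬ (h ∷ t) u∉ ∷ uq , Adj-sym a ∷ w , u∉X ∷ out) , ≤-refl

    extend-through-cycle : ∀ {C w c} → Cycle C → Unique C → All (_∉ X) C → w ∉ X → w ∉ C → c ∈ C → Adj w c →
                           LongerOutsidePath (length C)
    extend-through-cycle {C} {w} {c} cyc uq out w∉X w∉ c∈ a with rotate-to c∈ cyc
    ... | C′ , p , walk , _ =
      w , c ∷ C′ ,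
      ( ¬Any⇒All¬ (c ∷ C′) (w∉ ∘ ∈-resp-↭ p) ∷ Unique-resp-↭ (↭-sym p) uq
      , a ∷ walk
      , w∉X ∷ All-resp-↭ (↭-sym p) out ) ,
      ≤-reflexive (cong ℕ.suc (≡.sym (↭-length p)))

    close-up : ∀ {h t} → OutsidePath (h ∷ t) →
               NeighboursOutsideIn h (h ∷ t) → NeighboursOutsideIn (last⁺ h t) (h ∷ t) →
               ∃ λ C → C ↭ h ∷ t × Cycle C
    close-up {h} {t} (uq , w , _) nh ne =
      h ∷ mid ++ reverse (next ∷ after) ,
      subst (λ zs → h ∷ mid ++ reverse (next ∷ after) ↭ h ∷ zs) (≡.sym split)
            (prep h (++⁺ˡ mid (↭-reverse (next ∷ after)))) ,
      cycle-by-reversal mid after (subst (Walk ∘ (h ∷_)) split w)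
        (subst (λ z → Adj z (last⁺ h mid)) e≡ P-last) Q-next
      where
      e = last⁺ h t
      bound : length t < sumInit (𝟙 ∘ adj G e) (h ∷ t) + sumBy t (𝟙 ∘ adj G h)
      bound = begin-strict
        length t                                                   <⟨ n<1+n _ ⟩
        length (h ∷ t)                                             ≤⟨ Unique⇒length≤ uq ⟩
        N                                                          <⟨ ore e h ⟩
        degreeOutside e + degreeOutside h                          ≤⟨ +-mono-≤ (degreeOutside-≤ ne) (degreeOutside-≤ nh) ⟩
        sumBy (h ∷ t) (𝟙 ∘ adj G e) + sumBy (h ∷ t) (𝟙 ∘ adj G h) ≡⟨ cong₂ _+_ (sumBy-adj-last⁺ h t) (sumBy-adj-head h t) ⟩
        sumInit (𝟙 ∘ adj G e) (h ∷ t) + sumBy t (𝟙 ∘ adj G h)     ∎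
        where open ≤-Reasoning
      open Consecutive (consecutive-pigeonhole (adj G e) (adj G h) h t bound)
      e≡ : last⁺ h t ≡ last⁺ next after
      e≡ = trans (cong (last⁺ h) split) (last⁺-++ h mid next after)

    from-cycle : ∀ {C h} → Cycle C → Unique C → All (_∉ X) C → NeighboursOutsideIn h C →
                 ∃ HamiltonCycle ⊎ LongerOutsidePath (length C)
    from-cycle {C} {h} cyc uq out nh with any? (λ w → ¬? (w ∈? X) ×-dec ¬? (w ∈? C))
    ... | no none = inj₁ (C , cyc , record { unique = uq ; outside = out ; covers = covers })
      where
      covers : ∀ u → u ∉ X → u ∈ C
      covers u u∉X with u ∈? C
      ... | yes u∈ = u∈
      ... | no u∉  = ⊥-elim (none (u , u∉X , u∉))
    ... | yes (w , w∉X , w∉) with Any.any? (T? ∘ adj G w) C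
    ...   | yes hit = let c , c∈ , a = find hit in inj₂ (extend-through-cycle cyc uq out w∉X w∉ c∈ a)
    ...   | no miss = ⊥-elim (<⇒≱ (ore w h) (count-disjoint _ _ disjoint))
      where
      -- w has no neighbour on C, whereas every outside neighbour of h lies on C.
      disjoint : ∀ u → T (adj G w u ∧ not (u ∈ᵇ X)) → T (adj G h u ∧ not (u ∈ᵇ X)) → ⊥
      disjoint u tw th with Equivalence.to T-∧ tw | Equivalence.to T-∧ th
      ... | a , _ | b , u∉X = miss (lose (nh u b (∉ᵇ⇒∉ u∉X)) a)

    grow : ∀ {h t} → OutsidePath (h ∷ t) → ∃ HamiltonCycle ⊎ LongerOutsidePath (length (h ∷ t))
    grow {h} {t} p@(uq , _ , out) with outside-neighbour (last⁺ h t) (h ∷ t)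
    ... | inj₁ (u , a , u∉X , u∉) = inj₂ (extend-end p a u∉X u∉)
    ... | inj₂ ne with outside-neighbour h (h ∷ t)
    ...   | inj₁ (u , a , u∉X , u∉) = inj₂ (extend-start p a u∉X u∉)
    ...   | inj₂ nh with close-up p nh ne
    ...     | C , C↭ , cyc =
      Sum.map₂ (subst LongerOutsidePath (↭-length C↭))
               (from-cycle cyc (Unique-resp-↭ (↭-sym C↭) uq) (All-resp-↭ (↭-sym C↭) out)
                           (λ u a u∉X → ∈-resp-↭ (↭-sym C↭) (nh u a u∉X)))

    hamilton-cycle-from : ∀ k {h t} → OutsidePath (h ∷ t) → N < k + length (h ∷ t) → ∃ HamiltonCycle
    hamilton-cycle-from ℕ.zero    p lt = ⊥-elim (<⇒≱ lt (Unique⇒length≤ (proj₁ p)))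
    hamilton-cycle-from (ℕ.suc k) p lt with grow p
    ... | inj₁ hc                   = hc
    ... | inj₂ (_ , _ , p′ , longer) =
      hamilton-cycle-from k p′ (<-≤-trans lt (≤-trans (≤-reflexive (≡.sym (+-suc k _))) (+-monoʳ-≤ k longer)))

    degreeOutside-pos : ∀ v → 0 < degreeOutside v
    degreeOutside-pos v = n≢0⇒n>0 λ d≡0 → <⇒≱ (ore v v) (subst (λ d → d + d ≤ N) (≡.sym d≡0) z≤n)

    hamilton-cycle : Fin N → ∃ HamiltonCycle
    hamilton-cycle v with count-pos _ (degreeOutside-pos v)
    ... | u , t = hamilton-cycle-from N ([] ∷ [] , [-] , ∉ᵇ⇒∉ (proj₂ (Equivalence.to T-∧ t)) ∷ []) (m<m+n N (s≤s z≤n))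

    path-through-rotation : ∀ {s t c} mid next R → HamiltonCycle (c ∷ mid ++ next ∷ R) →
                            Adj t (last⁺ c mid) → Adj s next → SpanningOutsidePath s t
    path-through-rotation {s} {t} {c} mid next R (cyc , sp) a-t a-s = record
      { interior = next ∷ R ++ c ∷ mid
      ; chain    = walk⇒chain a-s (proj₁ (cycle-rotate (c ∷ mid) next R cyc))
                     (subst (λ z → Adj z t) (≡.sym (last⁺-++ next R c mid)) (Adj-sym a-t))
      ; spans    = SpansOutside-resp-↭ (++-comm (c ∷ mid) (next ∷ R)) sp
      }

    crossing-bound : ∀ s t {c cs} → SpansOutside (c ∷ cs) →
      length (cs ∷ʳ c) < sumInit (𝟙 ∘ adj G t) (c ∷ cs ∷ʳ c) + sumBy (cs ∷ʳ c) (𝟙 ∘ adj G s)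
    crossing-bound s t {c} {cs} sp = begin-strict
      length (cs ∷ʳ c)                                          ≡⟨ ↭-length (++-comm cs (c ∷ [])) ⟩
      length (c ∷ cs)                                           ≤⟨ Unique⇒length≤ (SpansOutside.unique sp) ⟩
      N                                                         <⟨ ore t s ⟩
      degreeOutside t + degreeOutside s                         ≤⟨ +-mono-≤ (degreeOutside-≤ (spans⇒neighbours sp))
                                                                            (degreeOutside-≤ (spans⇒neighbours sp)) ⟩
      sumBy (c ∷ cs) (𝟙 ∘ adj G t) + sumBy (c ∷ cs) (𝟙 ∘ adj G s) ≡⟨ cong₂ _+_ (sumInit-∷ʳ (𝟙 ∘ adj G t) c cs c)
                                                                             (sumBy-↭ (𝟙 ∘ adj G s) (++-comm cs (c ∷ []))) ⟨
      sumInit (𝟙 ∘ adj G t) (c ∷ cs ∷ʳ c) + sumBy (cs ∷ʳ c) (𝟙 ∘ adj G s) ∎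
      where open ≤-Reasoning

    path-through-cycle : ∀ s t {C} → HamiltonCycle C → SpanningOutsidePath s t
    path-through-cycle s t {[]} (_ , sp) =
      ⊥-elim (<⇒≱ (ore t s) (≤-trans (+-mono-≤ (degreeOutside-≤ nbs) (degreeOutside-≤ nbs)) z≤n))
      where
      nbs : ∀ {v} → NeighboursOutsideIn v []
      nbs = spans⇒neighbours sp
    path-through-cycle s t {c ∷ cs} hc@(cyc , sp)
      with consecutive-pigeonhole (adj G t) (adj G s) c (cs ∷ʳ c) (crossing-bound s t sp)
    ... | record { mid = mid ; next = next ; after = [] ; split = split ; P-last = a-t ; Q-next = a-s }
      with ∷ʳ-injective cs mid split
    ...   | refl , refl = record { interior = c ∷ cs ; chain = walk⇒chain a-s (proj₁ cyc) (Adj-sym a-t) ; spans = sp }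
    path-through-cycle s t {c ∷ cs} hc
      | record { mid = mid ; next = next ; after = a ∷ as ; split = split ; P-last = a-t ; Q-next = a-s } =
      path-through-rotation mid next (init⁺ a as) (subst (HamiltonCycle ∘ (c ∷_)) cs≡ hc) a-t a-s
      where
      cs≡ : cs ≡ mid ++ next ∷ init⁺ a as
      cs≡ = proj₁ (∷ʳ-injective cs _ (begin
        cs ∷ʳ c                                   ≡⟨ split ⟩
        mid ++ next ∷ a ∷ as                      ≡⟨ cong (λ zs → mid ++ next ∷ zs) (init⁺-∷ʳ-last⁺ a as) ⟨
        mid ++ next ∷ init⁺ a as ∷ʳ last⁺ a as    ≡⟨ ++-assoc mid (next ∷ init⁺ a as) (last⁺ a as ∷ []) ⟨
        (mid ++ next ∷ init⁺ a as) ∷ʳ last⁺ a as  ∎))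
        where open ≡.≡-Reasoning

    spanning-outside-path : ∀ s t → SpanningOutsidePath s t
    spanning-outside-path s t = path-through-cycle s t (proj₂ (hamilton-cycle s))

-- Private common neighbours

module CommonNeighbours {N : ℕ} (G : Graph N) {n : ℕ} (branch : Fin n → Fin N) where
  open Walks G
  open Counting {N}

  common : Fin n → Fin n → ℕ
  common i j = count (λ u → adj G (branch i) u ∧ adj G (branch j) u)

  fresh-common-neighbour : ∀ i j used → length used < common i j →
                           ∃ λ u → (Adj (branch i) u × Adj (branch j) u) × u ∉ used
  fresh-common-neighbour i j used lt
    with count-pos fresh (+-cancelˡ-< (length used) 0 (count fresh) enough)
    where
    both fresh : Fin N → Bool
    both u  = adj G (branch i) u ∧ adj G (branch j) u
    fresh u = both u ∧ not (u ∈ᵇ used)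
    enough : length used + 0 < length used + count fresh
    enough = begin-strict
      length used + 0                  ≡⟨ +-identityʳ _ ⟩
      length used                      <⟨ lt ⟩
      common i j                       ≤⟨ count-split both (_∈ᵇ used) ⟩
      count (_∈ᵇ used) + count fresh   ≤⟨ +-monoˡ-≤ (count fresh) (count-∈ᵇ used) ⟩
      length used + count fresh        ∎
      where open ≤-Reasoning
  ... | u , t with Equivalence.to T-∧ t
  ...   | b , u∉ = u , Equivalence.to T-∧ b , ∉ᵇ⇒∉ u∉

  Pair : Set
  Pair = Fin n × Fin n

  record Midpoints (pairs : List Pair) (used : List (Fin N)) : Set where
    field
      mid           : Fin n → Fin n → Fin N
      mid-adj       : ∀ {i j} → (i , j) ∈ pairs → Adj (branch i) (mid i j) × Adj (branch j) (mid i j)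
      mid-fresh     : ∀ {i j} → (i , j) ∈ pairs → mid i j ∉ used
      mid-injective : ∀ {i j i′ j′} → (i , j) ∈ pairs → (i′ , j′) ∈ pairs →
                      mid i j ≡ mid i′ j′ → (i , j) ≡ (i′ , j′)

  midpoints : ∀ pairs used → (∀ i j → length used + length pairs < common i j) → Midpoints pairs used
  midpoints []                  used _   = record
    { mid = λ i _ → branch i ; mid-adj = λ () ; mid-fresh = λ () ; mid-injective = λ () }
  midpoints ((i₀ , j₀) ∷ pairs) used big = record
    { mid = mid′ ; mid-adj = mid-adj′ ; mid-fresh = mid-fresh′ ; mid-injective = mid-injective′ }
    where
    first = fresh-common-neighbour i₀ j₀ used (≤-trans (s≤s (m≤m+n _ _)) (big i₀ j₀))
    u₀ = proj₁ first
    rest = midpoints pairs (u₀ ∷ used) (λ i j → subst (_< common i j) (+-suc _ _) (big i j))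
    open Midpoints rest

    _≟ₚ_ = ≡-dec _≟ᶠ_ _≟ᶠ_

    mid′ : Fin n → Fin n → Fin N
    mid′ i j with (i , j) ≟ₚ (i₀ , j₀)
    ... | yes _ = u₀
    ... | no _  = mid i j

    in-rest : ∀ {i j} → (i , j) ∈ (i₀ , j₀) ∷ pairs → (i , j) ≢ (i₀ , j₀) → (i , j) ∈ pairs
    in-rest (here eq) ne = ⊥-elim (ne eq)
    in-rest (there p) _  = p

    mid-adj′ : ∀ {i j} → (i , j) ∈ (i₀ , j₀) ∷ pairs → Adj (branch i) (mid′ i j) × Adj (branch j) (mid′ i j)
    mid-adj′ {i} {j} p with (i , j) ≟ₚ (i₀ , j₀)
    ... | yes refl = proj₁ (proj₂ first)
    ... | no ne    = mid-adj (in-rest p ne)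

    mid-fresh′ : ∀ {i j} → (i , j) ∈ (i₀ , j₀) ∷ pairs → mid′ i j ∉ used
    mid-fresh′ {i} {j} p with (i , j) ≟ₚ (i₀ , j₀)
    ... | yes _ = proj₂ (proj₂ first)
    ... | no ne = mid-fresh (in-rest p ne) ∘ there

    mid-injective′ : ∀ {i j i′ j′} → (i , j) ∈ (i₀ , j₀) ∷ pairs → (i′ , j′) ∈ (i₀ , j₀) ∷ pairs →
                     mid′ i j ≡ mid′ i′ j′ → (i , j) ≡ (i′ , j′)
    mid-injective′ {i} {j} {i′} {j′} p p′ eq with (i , j) ≟ₚ (i₀ , j₀) | (i′ , j′) ≟ₚ (i₀ , j₀)
    ... | yes refl | yes refl = refl
    ... | yes _    | no ne′   = ⊥-elim (mid-fresh (in-rest p′ ne′) (here (≡.sym eq)))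
    ... | no ne    | yes _    = ⊥-elim (mid-fresh (in-rest p ne) (here eq))
    ... | no ne    | no ne′   = mid-injective (in-rest p ne) (in-rest p′ ne′) eq

budget : ℕ → ℕ
budget n = n + n * n

degree-sum-after-removal : ∀ {N B x a b d e} → N + ℕ.suc (2 * B) ≤ d + e → d ≤ x + a → e ≤ x + b → x ≤ B →
                           N < a + b
degree-sum-after-removal {N} {B} {x} {a} {b} {d} {e} large d≤ e≤ x≤B =
  +-cancelʳ-≤ (2 * B) (ℕ.suc N) (a + b) (begin
    ℕ.suc N + 2 * B        ≡⟨ +-suc N (2 * B) ⟨
    N + ℕ.suc (2 * B)      ≤⟨ large ⟩
    d + e                  ≤⟨ +-mono-≤ d≤ e≤ ⟩
    x + a + (x + b)        ≡⟨ shuffle x a b ⟩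
    a + b + 2 * x          ≤⟨ +-monoʳ-≤ (a + b) (*-monoʳ-≤ 2 x≤B) ⟩
    a + b + 2 * B          ∎)
  where
  open ≤-Reasoning
  shuffle : ∀ x a b → x + a + (x + b) ≡ a + b + 2 * x
  shuffle = solve-∀

module SubdivisionConstruction {N : ℕ} (m : ℕ) (G : Graph N) (n≤N : 2 + m ≤ N)
  (degree-sum : ∀ v w → N + ℕ.suc (2 * budget (2 + m)) ≤ degree G v + degree G w) where
  open Walks G
  open Counting {N}

  n : ℕ
  n = 2 + m

  branch : Fin n → Fin N
  branch k = inject≤ k n≤N

  _≟ₚ_ = ≡-dec (_≟ᶠ_ {n}) (_≟ᶠ_ {n})

  special : Fin n × Fin n
  special = zero , suc zero

  Regular : Fin n × Fin n → Set
  Regular (i , j) = i <ᶠ j × (i , j) ≢ special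

  regular? : ∀ p → Dec (Regular p)
  regular? (i , j) = (i <ᶠ? j) ×-dec ¬? ((i , j) ≟ₚ special)

  pairs : List (Fin n × Fin n)
  pairs = filter regular? (cartesianProduct (allFin n) (allFin n))

  length-pairs : length pairs ≤ n * n
  length-pairs = ≤-trans (length-filter regular? (cartesianProduct (allFin n) (allFin n)))
    (≤-reflexive (trans (length-cartesianProduct (allFin n) (allFin n))
                        (cong₂ _*_ (length-allFin n) (length-allFin n))))

  branches : List (Fin N)
  branches = map branch (allFin n)

  length-branches : length branches ≡ n
  length-branches = trans (length-map branch (allFin n)) (length-allFin n)

  open CommonNeighbours G branch

  common-large : ∀ i j → length branches + length pairs < common i j
  common-large i j = begin-strict
    length branches + length pairs  ≤⟨ +-mono-≤ (≤-reflexive length-branches) length-pairs ⟩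
    budget n                        <⟨ s≤s (m≤m+n (budget n) _) ⟩
    ℕ.suc (2 * budget n)            ≤⟨ +-cancelˡ-≤ N _ _ (≤-trans (degree-sum (branch i) (branch j)) (count-∧ _ _)) ⟩
    common i j                      ∎
    where open ≤-Reasoning

  opaque
    chosenMidpoints : Midpoints pairs branches
    chosenMidpoints = midpoints pairs branches common-large

  open Midpoints chosenMidpoints

  mids : List (Fin N)
  mids = map (λ (i , j) → mid i j) pairs

  X : List (Fin N)
  X = branches ++ mids

  length-X : length X ≤ budget n
  length-X = begin
    length X                        ≡⟨ length-++ branches ⟩
    length branches + length mids   ≡⟨ cong₂ _+_ length-branches (length-map _ pairs) ⟩
    n + length pairs                ≤⟨ +-monoʳ-≤ n length-pairs ⟩
    budget n                        ∎
    where open ≤-Reasoning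

  open HamiltonPathOutside G X

  degree≤ : ∀ v → degree G v ≤ length X + degreeOutside v
  degree≤ v = ≤-trans (count-split (adj G v) (_∈ᵇ X)) (+-monoˡ-≤ (degreeOutside v) (count-∈ᵇ X))

  ore : ∀ v w → N < degreeOutside v + degreeOutside w
  ore v w = degree-sum-after-removal (degree-sum v w) (degree≤ v) (degree≤ w) length-X

  open Ore ore

  opaque
    longPath : SpanningOutsidePath (branch zero) (branch (suc zero))
    longPath = spanning-outside-path (branch zero) (branch (suc zero))

  open SpanningOutsidePath longPath renaming (interior to long-interior; chain to long-chain)
  open SpansOutside spans

  interior : Fin n → Fin n → List (Fin N)
  interior i j with (i , j) ≟ₚ special
  ... | yes _ = long-interior
  ... | no _  = mid i j ∷ []

  regular-pair : ∀ {i j} → i <ᶠ j → (i , j) ≢ special → (i , j) ∈ pairs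
  regular-pair {i} {j} i<j ne =
    ∈-filter⁺ regular? (∈-cartesianProduct⁺ (∈-allFin i) (∈-allFin j)) (i<j , ne)

  branch∈X : ∀ k → branch k ∈ X
  branch∈X k = ∈-++⁺ˡ (∈-map⁺ branch (∈-allFin k))

  mid∈X : ∀ {i j} → (i , j) ∈ pairs → mid i j ∈ X
  mid∈X p = ∈-++⁺ʳ branches (∈-map⁺ (λ (i , j) → mid i j) p)

  interior-chain : ∀ i j → i <ᶠ j → Chain G (branch i) (interior i j) (branch j)
  interior-chain i j i<j with (i , j) ≟ₚ special
  ... | yes refl = long-chain
  ... | no ne with mid-adj (regular-pair i<j ne)
  ...   | a , b = a , Adj-sym b

  interior-unique : ∀ i j → Unique (interior i j)
  interior-unique i j with (i , j) ≟ₚ special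
  ... | yes _ = unique
  ... | no _  = [] ∷ []

  interior-avoid : ∀ i j → i <ᶠ j → ∀ k v → v ∈ interior i j → v ≢ branch k
  interior-avoid i j i<j k v v∈ with (i , j) ≟ₚ special
  ... | yes _ = λ { refl → All.lookup outside v∈ (branch∈X k) }
  ... | no ne with v∈
  ...   | here refl = λ eq → mid-fresh (regular-pair i<j ne) (subst (_∈ branches) (≡.sym eq) (∈-map⁺ branch (∈-allFin k)))

  interior-disjoint : ∀ i j → i <ᶠ j → ∀ i′ j′ → i′ <ᶠ j′ → ∀ v → v ∈ interior i j → v ∈ interior i′ j′ →
                      (i ≡ i′) × (j ≡ j′)
  interior-disjoint i j i<j i′ j′ i′<j′ v v∈ v∈′ with (i , j) ≟ₚ special | (i′ , j′) ≟ₚ special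
  ... | yes refl | yes refl = refl , refl
  ... | yes _    | no ne′   with v∈′
  ...   | here refl = ⊥-elim (All.lookup outside v∈ (mid∈X (regular-pair i′<j′ ne′)))
  interior-disjoint i j i<j i′ j′ i′<j′ v v∈ v∈′ | no ne | yes _ with v∈
  ...   | here refl = ⊥-elim (All.lookup outside v∈′ (mid∈X (regular-pair i<j ne)))
  interior-disjoint i j i<j i′ j′ i′<j′ v v∈ v∈′ | no ne | no ne′ with v∈ | v∈′
  ...   | here refl | here eq = ,-injective (mid-injective (regular-pair i<j ne) (regular-pair i′<j′ ne′) eq)

  mid∈interior : ∀ {i j} → (i , j) ≢ special → mid i j ∈ interior i j
  mid∈interior {i} {j} ne with (i , j) ≟ₚ special
  ... | yes eq = ⊥-elim (ne eq)
  ... | no _   = here refl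

  interior-spanning : ∀ v → (∃[ k ] v ≡ branch k) ⊎ (∃[ i ] ∃[ j ] Σ (i <ᶠ j) λ p → v ∈ interior i j)
  interior-spanning v with v ∈? X
  ... | no v∉X = inj₂ (zero , suc zero , s≤s z≤n , covers v v∉X)
  ... | yes v∈X with ∈-++⁻ branches v∈X
  ...   | inj₁ v∈b = let k , _ , eq = ∈-map⁻ branch v∈b in inj₁ (k , eq)
  ...   | inj₂ v∈m with ∈-map⁻ (λ (i , j) → mid i j) v∈m
  ...     | (i , j) , p , refl with ∈-filter⁻ regular? {xs = cartesianProduct (allFin n) (allFin n)} p
  ...       | _ , i<j , ne = inj₂ (i , j , i<j , mid∈interior ne)

  subdivision : SpanningSubdivision G n
  subdivision = record
    { branch       = branch
    ; branch-inj   = λ i j → inject≤-injective n≤N n≤N i j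
    ; interior     = λ i j _ → interior i j
    ; path         = interior-chain
    ; int-unique   = λ i j _ → interior-unique i j
    ; int-avoid    = interior-avoid
    ; int-disjoint = interior-disjoint
    ; spanning     = interior-spanning
    }

twice-degree-bound : ∀ q p {N T d} .{{_ : ℕ.NonZero q}} → (q + p) * N ≤ 2 * q * d → q * T ≤ p * N → N + T ≤ d + d
twice-degree-bound q p {N} {T} {d} δ qT≤pN = *-cancelˡ-≤ q (begin
  q * (N + T)     ≡⟨ *-distribˡ-+ q N T ⟩
  q * N + q * T   ≤⟨ +-monoʳ-≤ (q * N) qT≤pN ⟩
  q * N + p * N   ≡⟨ *-distribʳ-+ N q p ⟨
  (q + p) * N     ≤⟨ δ ⟩
  2 * q * d       ≡⟨ regroup q d ⟩
  q * (d + d)     ∎)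
  where
  open ≤-Reasoning
  regroup : ∀ q d → 2 * q * d ≡ q * (d + d)
  regroup = solve-∀

≤-+-of-doubles : ∀ {a b c} → a ≤ b + b → a ≤ c + c → a ≤ b + c
≤-+-of-doubles {b = b} {c} a≤2b a≤2c with ≤-total b c
... | inj₁ b≤c = ≤-trans a≤2b (+-monoʳ-≤ b b≤c)
... | inj₂ c≤b = ≤-trans a≤2c (+-monoˡ-≤ c c≤b)

budget-bound : ∀ m → ℕ.suc (2 * budget (2 + m)) ≤ 7 * (ℕ.suc m * (2 + m))
budget-bound m = subst (ℕ.suc (2 * budget (2 + m)) ≤_) (≡.sym (expand m)) (m≤m+n _ _)
  where
  expand : ∀ m → 7 * (ℕ.suc m * (2 + m)) ≡ ℕ.suc (2 * (2 + m + (2 + m) * (2 + m))) + (5 * m * m + 11 * m + 1)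
  expand = solve-∀

degree-sum-bound : ∀ p q m {N d e} → let C₀ = 7 * ℕ.suc q; n = 2 + m in
  (ℕ.suc q + ℕ.suc p) * N ≤ 2 * ℕ.suc q * d → (ℕ.suc q + ℕ.suc p) * N ≤ 2 * ℕ.suc q * e →
  C₀ * ((n ∸ 1) * n) ≤ N → N + ℕ.suc (2 * budget n) ≤ d + e
degree-sum-bound p q m {N} {d} {e} δd δe large =
  ≤-+-of-doubles {b = d} {c = e} (twice-degree-bound (ℕ.suc q) (ℕ.suc p) δd qT≤pN)
                                 (twice-degree-bound (ℕ.suc q) (ℕ.suc p) δe qT≤pN)
  where
  qT≤pN : ℕ.suc q * ℕ.suc (2 * budget (2 + m)) ≤ ℕ.suc p * N
  qT≤pN = begin
    ℕ.suc q * ℕ.suc (2 * budget (2 + m))      ≤⟨ *-monoʳ-≤ (ℕ.suc q) (budget-bound m) ⟩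
    ℕ.suc q * (7 * (ℕ.suc m * (2 + m)))       ≡⟨ regroup (ℕ.suc q) (ℕ.suc m * (2 + m)) ⟩
    7 * ℕ.suc q * (ℕ.suc m * (2 + m))         ≤⟨ large ⟩
    N                                         ≤⟨ m≤n*m N (ℕ.suc p) ⟩
    ℕ.suc p * N                               ∎
    where
    open ≤-Reasoning
    regroup : ∀ q k → q * (7 * k) ≡ 7 * q * k
    regroup = solve-∀

branches-fit : ∀ q m {N} → 7 * ℕ.suc q * (ℕ.suc m * (2 + m)) ≤ N → 2 + m ≤ N
branches-fit q m large = ≤-trans (m≤n*m (2 + m) (ℕ.suc m)) (≤-trans (m≤n*m _ (7 * ℕ.suc q)) large)

theorem1p2 : (p q : ℕ) → 0 < p → 0 < q →
    ∃[ C₀ ] (0 < C₀ × ((n N : ℕ) → 2 ≤ n → C₀ * ((n ∸ 1) * n) ≤ N →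
      (G : Graph N) → ((v : _) → (q + p) * N ≤ 2 * q * degree G v) →
      SpanningSubdivision G n))
theorem1p2 0 q () _
theorem1p2 p 0 _ ()
theorem1p2 (ℕ.suc p) (ℕ.suc q) _ _ = 7 * ℕ.suc q , s≤s z≤n , subdivision
  where
  subdivision : (n N : ℕ) → 2 ≤ n → 7 * ℕ.suc q * ((n ∸ 1) * n) ≤ N → (G : Graph N) →
                (∀ v → (ℕ.suc q + ℕ.suc p) * N ≤ 2 * ℕ.suc q * degree G v) → SpanningSubdivision G n
  subdivision 0 N () large G δ
  subdivision 1 N (s≤s ()) large G δ
  subdivision (ℕ.suc (ℕ.suc m)) N _ large G δ =
    SubdivisionConstruction.subdivision m G (branches-fit q m large) (λ v w → degree-sum-bound p q m (δ v) (δ w) large)
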